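{- There exists an $\mathrm{MSO}$ interpretation $\Theta$ such that $\Theta(\mathsf{Power}\text{ - }\mathsf{graphs})$ contains (isomorphic copies of) all square grids.
   Context: For $n\ge1$, $D_n$ is the graph with vertex set $\{1,\dots,n\}$ in which $i$ and $j$ are adjacent iff either $|i-j|=1$, or $i\neq j$ and the largest power of $2$ dividing $i$ equals the largest power of $2$ dividing $j$. $\mathsf{Power}\text{ - }\mathsf{graphs}$ is the class of all graphs isomorphic to an induced subgraph of some $D_n$. An $\mathrm{MSO}$ interpretation with parameters $\bar Z$ (set variables) is a pair $\Psi(\bar Z)=(\psi(x,\bar Z),\psi_E(x,y,\bar Z))$ of $\mathrm{MSO}$ formulas over graphs; for a graph $G$ and subsets $\bar A$ of $V(G)$, $\Psi((G,\bar A))$ has vertex set $\{a:G\models\psi(a,\bar A)\}$ and edge relation $\{(a,b):G\models\psi_E(a,b,\bar A)\}$, and $\Psi(\mathcal{C})=\{\Psi((G,\bar A)): G\in\mathcal{C}, \bar A \text{ arbitrary}\}$. The $n\times n$ grid has vertices $(i,j)$, $1\le i,j\le n$, with $(i,j)$ adjacent to $(i,j+1)$ and $(i+1,j)$ when these exist. -}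

module Defs where

open import Data.Nat using (ℕ; zero; suc; _^_; _≤_)
open import Data.Nat.Divisibility using (_∣_)
open import Data.Fin using (Fin; toℕ)
open import Data.Bool using (Bool; T)
open import Data.Product using (Σ; _×_; _,_; proj₁; proj₂)
open import Data.Sum using (_⊎_)
open import Data.Empty using (⊥)
open import Relation.Nullary using (¬_)
open import Relation.Binary.PropositionalEquality using (_≡_; _≢_)
open import Function.Bundles using (_⇔_)
open import Data.Unit using () renaming (⊤ to Unit)
open import Data.Vec.Functional using () renaming (_∷_ to _∷ᶠ_; [] to []ᶠ)

-- A graph is given by a carrier type C, a vertex predicate V
-- (the vertex set is {x : C | V x}) and an edge relation E on C
-- (only relevant between vertices).  Vertex sets are subsets of a
-- carrier so that MSO interpretations (whose universe is a definable
-- subset of V(G)) fit directly.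

record Graph : Set₁ where
  field
    C : Set
    V : C → Set
    E : C → C → Set
open Graph public

record _≅_ (G H : Graph) : Set where
  field
    f     : C G → C H
    pres  : ∀ x → V G x → V H (f x)
    inj   : ∀ x y → V G x → V G y → f x ≡ f y → x ≡ y
    surj  : ∀ y → V H y → Σ (C G) λ x → V G x × f x ≡ y
    edges : ∀ x y → V G x → V G y → (E G x y ⇔ E H (f x) (f y))

LargestPow2 : ℕ → ℕ → Set
LargestPow2 e m = (2 ^ e ∣ m) × ¬ (2 ^ suc e ∣ m)

DAdj : ℕ → ℕ → Set
DAdj a b = (suc a ≡ b ⊎ suc b ≡ a)
         ⊎ (a ≢ b × Σ ℕ λ e → LargestPow2 e a × LargestPow2 e b)

-- vertex i : Fin n stands for the number toℕ i + 1 ∈ {1,…,n}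
D : ℕ → Graph
D n = record { C = Fin n ; V = λ _ → Unit ; E = λ i j → DAdj (suc (toℕ i)) (suc (toℕ j)) }

Induced : (G : Graph) → (C G → Bool) → Graph
Induced G S = record { C = C G ; V = λ x → V G x × T (S x) ; E = E G }

IsPowerGraph : Graph → Set
IsPowerGraph G = Σ ℕ λ n → Σ (Fin n → Bool) λ S → G ≅ Induced (D n) S

-- Grids: vertex (i , j) : Fin n × Fin n stands for (toℕ i + 1 , toℕ j + 1).

GridAdj : {n : ℕ} → Fin n × Fin n → Fin n × Fin n → Set
GridAdj (i , j) (i' , j') =
    (i ≡ i' × (suc (toℕ j) ≡ toℕ j' ⊎ suc (toℕ j') ≡ toℕ j))
  ⊎ (j ≡ j' × (suc (toℕ i) ≡ toℕ i' ⊎ suc (toℕ i') ≡ toℕ i))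

Grid : ℕ → Graph
Grid n = record { C = Fin n × Fin n ; V = λ _ → Unit ; E = GridAdj }

-- MSO over graphs.  Formula m k has m free first-order (vertex)
-- variables and k free set variables (de Bruijn, Fin-indexed).

data Formula (m k : ℕ) : Set where
  edge  : Fin m → Fin m → Formula m k
  eq    : Fin m → Fin m → Formula m k
  mem   : Fin m → Fin k → Formula m k
  true false : Formula m k
  not   : Formula m k → Formula m k
  and or imp : Formula m k → Formula m k → Formula m k
  ex1 all1 : Formula (suc m) k → Formula m k
  ex2 all2 : Formula m (suc k) → Formula m k

Subset : Graph → Set
Subset G = C G → Bool

⟦_⟧ : ∀ {m k} → Formula m k → (G : Graph) → (Fin m → C G) → (Fin k → Subset G) → Set
⟦ edge x y ⟧ G ρ σ = E G (ρ x) (ρ y)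
⟦ eq x y ⟧ G ρ σ = ρ x ≡ ρ y
⟦ mem x X ⟧ G ρ σ = T (σ X (ρ x))
⟦ true ⟧ G ρ σ = Unit
⟦ false ⟧ G ρ σ = ⊥
⟦ not φ ⟧ G ρ σ = ¬ ⟦ φ ⟧ G ρ σ
⟦ and φ ψ ⟧ G ρ σ = ⟦ φ ⟧ G ρ σ × ⟦ ψ ⟧ G ρ σ
⟦ or φ ψ ⟧ G ρ σ = ⟦ φ ⟧ G ρ σ ⊎ ⟦ ψ ⟧ G ρ σ
⟦ imp φ ψ ⟧ G ρ σ = ⟦ φ ⟧ G ρ σ → ⟦ ψ ⟧ G ρ σ
⟦ ex1 φ ⟧ G ρ σ = Σ (C G) λ a → V G a × ⟦ φ ⟧ G (a ∷ᶠ ρ) σ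
⟦ all1 φ ⟧ G ρ σ = (a : C G) → V G a → ⟦ φ ⟧ G (a ∷ᶠ ρ) σ
⟦ ex2 φ ⟧ G ρ σ = Σ (Subset G) λ A → ⟦ φ ⟧ G ρ (A ∷ᶠ σ)
⟦ all2 φ ⟧ G ρ σ = (A : Subset G) → ⟦ φ ⟧ G ρ (A ∷ᶠ σ)

-- MSO interpretation with p set parameters Z̄:
-- Ψ(Z̄) = (ψ(x, Z̄), ψ_E(x, y, Z̄)).  Variable 0 is x, variable 1 is y.
record Interpretation : Set where
  field
    params : ℕ
    ψ      : Formula 1 params
    ψE     : Formula 2 params
open Interpretation public

apply : (Ψ : Interpretation) (G : Graph) → (Fin (params Ψ) → Subset G) → Graph
apply Ψ G A = record
  { C = C G
  ; V = λ a → V G a × ⟦ ψ Ψ ⟧ G (a ∷ᶠ []ᶠ) A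
  ; E = λ a b → ⟦ ψE Ψ ⟧ G (a ∷ᶠ b ∷ᶠ []ᶠ) A
  }

-- Blow up every cell of the n × n grid into a block of B − 1 consecutive numbers (the offsets
-- 1 … B − 1 above a multiple of B, which itself is left out), and let G be the subgraph of D_{n²B}
-- induced by all these numbers.  Equal 2-adic valuation forces equal parity, so the D-edges joining
-- numbers of different parity are exactly the successor edges; with the even numbers as a parameter,
-- "p lies in the block of x" becomes MSO-definable as reachability along such edges.
-- Every grid edge {c, d} gets its own exponent k < K, and both blocks c and d contain the port with
-- offset 2^k, whose 2-adic valuation is exactly k.  Ports are even, hence never successive, so two
-- ports are D-adjacent iff they share k.  Thus two blocks contain distinct adjacent ports iff their
-- cells are adjacent in the grid, and Θ joins the representatives (offset 1) of such blocks.

module Submission where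

open import Defs
open import Data.Nat using (ℕ; zero; suc; pred; _+_; _*_; _^_; _∸_; _⊓_; _⊔_; _≤_; _<_; _<ᵇ_; z≤n; s≤s; z<s; NonZero; >-nonZero; _%_; _/_)
  renaming (_≟_ to _≟ℕ_)
open import Data.Nat.Properties
open import Data.Nat.DivMod using (_mod_; m≡m%n+[m/n]*n; [m+kn]%n≡m%n; m<n⇒m%n≡m; m%n<n; m*n%n≡0; m<n*o⇒m/o<n)
open import Data.Nat.Divisibility using (_∣_; _∣?_; ∣-trans; ∣-refl; ∣m∣n⇒∣m+n; ∣m+n∣m⇒∣n; m∣m*n; _∣0; ∣1⇒≡1; >⇒∤)
open import Data.Fin using (Fin; toℕ; fromℕ<; combine; remQuot) renaming (zero to fzero; suc to fsuc)
open import Data.Fin.Properties using (toℕ<n; toℕ-injective; toℕ-fromℕ<; combine-injectiveˡ; combine-injectiveʳ; combine-remQuot; any?)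
  renaming (_≟_ to _≟ᶠ_)
open import Data.Bool using (Bool; T)
open import Data.Product using (Σ; ∃; _×_; _,_; proj₁; proj₂; uncurry)
open import Data.Product.Properties using (≡-dec)
open import Data.Sum using (_⊎_; inj₁; inj₂; [_,_]′; swap)
open import Data.Empty using (⊥-elim)
open import Data.Unit using (tt)
open import Data.Vec.Functional using () renaming (_∷_ to _∷ᶠ_; [] to []ᶠ)
open import Function using (_∘_)
open import Function.Bundles using (_⇔_; mk⇔)
open import Relation.Nullary using (¬_; Dec)
open import Relation.Nullary.Decidable using (⌊_⌋; map′; _×-dec_; _⊎-dec_; toWitness; fromWitness)
open import Relation.Unary using (Pred; Decidable)
open import Relation.Binary.Definitions using (tri<; tri≈; tri>)
open import Relation.Binary.PropositionalEquality using (_≡_; _≢_; refl; sym; trans; cong; cong₂; subst; subst₂)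
open ≤-Reasoning

[n*q+o]<m*n : ∀ {m n q o} → q < m → o < n → n * q + o < m * n
[n*q+o]<m*n {m} {n} {q} {o} q<m o<n = begin-strict
  n * q + o   <⟨ +-monoʳ-< (n * q) o<n ⟩
  n * q + n   ≡⟨ +-comm (n * q) n ⟩
  n + n * q   ≡⟨ *-suc n q ⟨
  n * suc q   ≤⟨ *-monoʳ-≤ n q<m ⟩
  n * m       ≡⟨ *-comm n m ⟩
  m * n       ∎

[n*q+o]%n≡o : ∀ {n} .{{_ : NonZero n}} q {o} → o < n → (n * q + o) % n ≡ o
[n*q+o]%n≡o {n} q {o} o<n = begin-equality
  (n * q + o) % n   ≡⟨ cong (_% n) (trans (+-comm (n * q) o) (cong (o +_) (*-comm n q))) ⟩
  (o + q * n) % n   ≡⟨ [m+kn]%n≡m%n o q n ⟩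
  o % n             ≡⟨ m<n⇒m%n≡m o<n ⟩
  o                 ∎

*+-injective : ∀ {n} .{{_ : NonZero n}} {q q' o o'} → o < n → o' < n →
  n * q + o ≡ n * q' + o' → q ≡ q' × o ≡ o'
*+-injective {n} {q = q} {q'} {o} {o'} o<n o'<n e = q≡q' , o≡o'
  where
  o≡o' : o ≡ o'
  o≡o' = trans (sym ([n*q+o]%n≡o q o<n)) (trans (cong (_% n) e) ([n*q+o]%n≡o q' o'<n))
  q≡q' : q ≡ q'
  q≡q' = *-cancelˡ-≡ q q' n (+-cancelʳ-≡ o (n * q) (n * q') (trans e (cong (n * q' +_) (sym o≡o'))))

suc-*+-injective : ∀ {n} .{{_ : NonZero n}} {q q' o o'} → o < n → 0 < o' → o' < n →
  suc (n * q + o) ≡ n * q' + o' → q ≡ q'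
suc-*+-injective {n} {q = q} {q'} {o} {suc o'} o<n _ o'<n e =
  proj₁ (*+-injective o<n (<-trans (n<1+n o') o'<n) (suc-injective (trans e (+-suc (n * q') o'))))

m≤o*n∧0<m%n⇒m/n<o : ∀ {n} .{{_ : NonZero n}} {m o} → m ≤ o * n → 0 < m % n → m / n < o
m≤o*n∧0<m%n⇒m/n<o {n} {m} {o} m≤o*n 0<m%n with m≤n⇒m<n∨m≡n m≤o*n
... | inj₁ m<o*n = m<n*o⇒m/o<n m<o*n
... | inj₂ refl = ⊥-elim (<-irrefl (sym (m*n%n≡0 o n)) 0<m%n)

⊓-⊔-cases : ∀ a b → (a ⊓ b ≡ a × a ⊔ b ≡ b) ⊎ (a ⊓ b ≡ b × a ⊔ b ≡ a)
⊓-⊔-cases a b with ≤-total a b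
... | inj₁ a≤b = inj₁ (m≤n⇒m⊓n≡m a≤b , m≤n⇒m⊔n≡n a≤b)
... | inj₂ b≤a = inj₂ (m≥n⇒m⊓n≡n b≤a , m≥n⇒m⊔n≡m b≤a)

⊓-⊔-unordered : ∀ {a b a' b'} → a ⊓ b ≡ a' ⊓ b' → a ⊔ b ≡ a' ⊔ b' →
  (a ≡ a' × b ≡ b') ⊎ (a ≡ b' × b ≡ a')
⊓-⊔-unordered {a} {b} {a'} {b'} e⊓ e⊔ with ⊓-⊔-cases a b | ⊓-⊔-cases a' b'
... | inj₁ (m₁ , M₁) | inj₁ (m₂ , M₂) = inj₁ (trans (sym m₁) (trans e⊓ m₂) , trans (sym M₁) (trans e⊔ M₂))
... | inj₁ (m₁ , M₁) | inj₂ (m₂ , M₂) = inj₂ (trans (sym m₁) (trans e⊓ m₂) , trans (sym M₁) (trans e⊔ M₂))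
... | inj₂ (m₁ , M₁) | inj₁ (m₂ , M₂) = inj₂ (trans (sym M₁) (trans e⊔ M₂) , trans (sym m₁) (trans e⊓ m₂))
... | inj₂ (m₁ , M₁) | inj₂ (m₂ , M₂) = inj₁ (trans (sym M₁) (trans e⊔ M₂) , trans (sym m₁) (trans e⊓ m₂))

m^n∣m^o : ∀ m {n o} → n ≤ o → m ^ n ∣ m ^ o
m^n∣m^o m {n} {o} n≤o = subst (m ^ n ∣_) m^[n+[o∸n]]≡m^o (m∣m*n (m ^ (o ∸ n)))
  where
  m^[n+[o∸n]]≡m^o : m ^ n * m ^ (o ∸ n) ≡ m ^ o
  m^[n+[o∸n]]≡m^o = trans (sym (^-distribˡ-+-* m n (o ∸ n))) (cong (m ^_) (m+[n∸m]≡n n≤o))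

LargestPow2-unique : ∀ {e e' a} → LargestPow2 e a → LargestPow2 e' a → e ≡ e'
LargestPow2-unique {e} {e'} (2^e∣a , 2^1+e∤a) (2^e'∣a , 2^1+e'∤a) with <-cmp e e'
... | tri< e<e' _ _ = ⊥-elim (2^1+e∤a (∣-trans (m^n∣m^o 2 e<e') 2^e'∣a))
... | tri≈ _ e≡e' _ = e≡e'
... | tri> _ _ e'<e = ⊥-elim (2^1+e'∤a (∣-trans (m^n∣m^o 2 e'<e) 2^e∣a))

LargestPow2-*+ : ∀ {k K} q → k < K → LargestPow2 k (2 ^ K * q + 2 ^ k)
LargestPow2-*+ {k} {K} q k<K =
    ∣m∣n⇒∣m+n (∣-trans (m^n∣m^o 2 (<⇒≤ k<K)) (m∣m*n q)) ∣-refl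
  , λ 2^1+k∣ → 2^1+k∤2^k (∣m+n∣m⇒∣n 2^1+k∣ (∣-trans (m^n∣m^o 2 k<K) (m∣m*n q)))
  where
  2^1+k∤2^k : ¬ (2 ^ suc k ∣ 2 ^ k)
  2^1+k∤2^k = >⇒∤ {{m^n≢0 2 k}} (^-monoʳ-< 2 (s≤s (s≤s z≤n)) (n<1+n k))

LargestPow2-suc⇒2∣ : ∀ {e a} → LargestPow2 (suc e) a → 2 ∣ a
LargestPow2-suc⇒2∣ {e} (2^1+e∣a , _) = ∣-trans (m∣m*n (2 ^ e)) 2^1+e∣a

2∣⇒2∤suc : ∀ {a} → 2 ∣ a → ¬ (2 ∣ suc a)
2∣⇒2∤suc {a} 2∣a 2∣1+a with ∣1⇒≡1 (∣m+n∣m⇒∣n (subst (2 ∣_) (+-comm 1 a) 2∣1+a) 2∣a)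
... | ()

2∣-or-2∣suc : ∀ a → 2 ∣ a ⊎ 2 ∣ suc a
2∣-or-2∣suc zero = inj₁ (2 ∣0)
2∣-or-2∣suc (suc a) = [ inj₂ ∘ ∣m∣n⇒∣m+n ∣-refl , inj₁ ]′ (2∣-or-2∣suc a)

evens-not-successive : ∀ {a b} → 2 ∣ a → 2 ∣ b → ¬ (suc a ≡ b ⊎ suc b ≡ a)
evens-not-successive 2∣a 2∣b (inj₁ refl) = 2∣⇒2∤suc 2∣a 2∣b
evens-not-successive 2∣a 2∣b (inj₂ refl) = 2∣⇒2∤suc 2∣b 2∣a

Differ : Bool → Bool → Set
Differ u v = (T u × ¬ T v) ⊎ (¬ T u × T v)

Differ-⌊⌋ : ∀ {a b} {A : Set a} {B : Set b} {a? : Dec A} {b? : Dec B} →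
  Differ ⌊ a? ⌋ ⌊ b? ⌋ → (A × ¬ B) ⊎ (¬ A × B)
Differ-⌊⌋ {a? = a?} {b?} (inj₁ (Ta , ¬Tb)) = inj₁ (toWitness {a? = a?} Ta , ¬Tb ∘ fromWitness)
Differ-⌊⌋ {a? = a?} {b?} (inj₂ (¬Ta , Tb)) = inj₂ (¬Ta ∘ fromWitness , toWitness {a? = b?} Tb)

Differ-2∣?-suc : ∀ a → Differ ⌊ 2 ∣? a ⌋ ⌊ 2 ∣? suc a ⌋
Differ-2∣?-suc a = [ even , odd ]′ (2∣-or-2∣suc a)
  where
  even : 2 ∣ a → Differ ⌊ 2 ∣? a ⌋ ⌊ 2 ∣? suc a ⌋
  even 2∣a = inj₁ (fromWitness 2∣a , 2∣⇒2∤suc 2∣a ∘ toWitness)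
  odd : 2 ∣ suc a → Differ ⌊ 2 ∣? a ⌋ ⌊ 2 ∣? suc a ⌋
  odd 2∣1+a = inj₂ ((λ 2∣a → 2∣⇒2∤suc (toWitness 2∣a) 2∣1+a) , fromWitness 2∣1+a)

LargestPow2-2∣ : ∀ {e a b} → LargestPow2 e a → LargestPow2 e b → 2 ∣ a → 2 ∣ b
LargestPow2-2∣ {zero} (_ , 2∤a) _ 2∣a = ⊥-elim (2∤a 2∣a)
LargestPow2-2∣ {suc e} _ vb _ = LargestPow2-suc⇒2∣ {e} vb

DAdj-Differ⇒successive : ∀ {a b} → DAdj a b → Differ ⌊ 2 ∣? a ⌋ ⌊ 2 ∣? b ⌋ → suc a ≡ b ⊎ suc b ≡ a
DAdj-Differ⇒successive (inj₁ successive) _ = successive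
DAdj-Differ⇒successive (inj₂ (_ , e , va , vb)) d with Differ-⌊⌋ d
... | inj₁ (2∣a , 2∤b) = ⊥-elim (2∤b (LargestPow2-2∣ {e} va vb 2∣a))
... | inj₂ (2∤a , 2∣b) = ⊥-elim (2∤a (LargestPow2-2∣ {e} vb va 2∣b))

-- Step, Reach and Linked are, definitionally, the semantics of stepFormula, reachFormula and ψE Θ.
Step : (G : Graph) → Subset G → C G → C G → Set
Step G P a b = E G a b × Differ (P a) (P b)

Reach : (G : Graph) → Subset G → C G → C G → Set
Reach G P x p = (X : Subset G) → T (X x) →
  ((a : C G) → V G a → (b : C G) → V G b → T (X a) → Step G P a b → T (X b)) → T (X p)

reach-refl : ∀ {G P x} → Reach G P x x
reach-refl X Xx _ = Xx

reach-step : ∀ {G P x a b} → Reach G P x a → V G a → V G b → Step G P a b → Reach G P x b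
reach-step x⇝a va vb a→b X Xx closed = closed _ va _ vb (x⇝a X Xx closed) a→b

Linked : (G : Graph) → (P M : Subset G) → C G → C G → Set
Linked G P M x y = Σ (C G) λ p → V G p × Σ (C G) λ q → V G q ×
  (Reach G P x p × (Reach G P y q × (T (M p) × (T (M q) × (E G p q × p ≢ q)))))

stepFormula : ∀ {m k} → Fin m → Fin m → Fin k → Formula m k
stepFormula a b P = and (edge a b) (or (and (mem a P) (not (mem b P))) (and (not (mem a P)) (mem b P)))

reachFormula : ∀ {m k} → Fin m → Fin m → Fin k → Formula m k
reachFormula {m} {k} x p P = all2 (imp (mem x X) (imp closed (mem p X)))
  where
  X : Fin (suc k)
  X = fzero
  closed : Formula m (suc k)
  closed = all1 (all1 (imp (mem (fsuc fzero) X) (imp (stepFormula (fsuc fzero) fzero (fsuc P)) (mem fzero X))))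

Θ : Interpretation
Θ = record
  { params = 3
  ; ψ      = mem fzero R
  ; ψE     = ex1 (ex1 (and (reachFormula x p P) (and (reachFormula y q P)
               (and (mem p M) (and (mem q M) (and (edge p q) (not (eq p q))))))))
  }
  where
  R P M : Fin 3
  R = fzero
  P = fsuc fzero
  M = fsuc (fsuc fzero)
  q p x y : Fin 4
  q = fzero
  p = fsuc fzero
  x = fsuc (fsuc fzero)
  y = fsuc (fsuc (fsuc fzero))

GridAdj? : ∀ {n} (c d : Fin n × Fin n) → Dec (GridAdj c d)
GridAdj? (i , j) (i' , j') =
      (i ≟ᶠ i' ×-dec (suc (toℕ j) ≟ℕ toℕ j' ⊎-dec suc (toℕ j') ≟ℕ toℕ j))
  ⊎-dec (j ≟ᶠ j' ×-dec (suc (toℕ i) ≟ℕ toℕ i' ⊎-dec suc (toℕ i') ≟ℕ toℕ i))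

GridAdj-sym : ∀ {n} {c d : Fin n × Fin n} → GridAdj c d → GridAdj d c
GridAdj-sym (inj₁ (refl , s)) = inj₁ (refl , swap s)
GridAdj-sym (inj₂ (refl , s)) = inj₂ (refl , swap s)

GridAdj-irrefl : ∀ {n} {c : Fin n × Fin n} → ¬ GridAdj c c
GridAdj-irrefl (inj₁ (_ , s)) = [ 1+n≢n , 1+n≢n ]′ s
GridAdj-irrefl (inj₂ (_ , s)) = [ 1+n≢n , 1+n≢n ]′ s

any²? : ∀ {m n p} {P : Pred (Fin m × Fin n) p} → Decidable P → Dec (∃ P)
any²? P? = map′ (λ (i , j , Pij) → (i , j) , Pij) (λ ((i , j) , Pij) → i , j , Pij)
  (any? λ i → any? λ j → P? (i , j))

module BlockGraph (n : ℕ) .{{_ : NonZero n}} where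

  Cell : Set
  Cell = Fin n × Fin n

  N² : ℕ
  N² = n * n

  instance
    N²≢0 : NonZero N²
    N²≢0 = m*n≢0 n n

  cellIndex : Cell → ℕ
  cellIndex = toℕ ∘ uncurry combine

  cellIndex< : ∀ c → cellIndex c < N²
  cellIndex< c = toℕ<n (uncurry combine c)

  cellIndex-injective : ∀ {c d} → cellIndex c ≡ cellIndex d → c ≡ d
  cellIndex-injective {i , j} {i' , j'} e
    with refl ← combine-injectiveˡ i j i' j' (toℕ-injective e)
    with refl ← combine-injectiveʳ i j i' j' (toℕ-injective e) = refl

  cellIndex-surjective : ∀ {k} → k < N² → Σ Cell λ c → cellIndex c ≡ k
  cellIndex-surjective k<N² = remQuot {n} n (fromℕ< k<N²) ,
    trans (cong toℕ (combine-remQuot {n} n (fromℕ< k<N²))) (toℕ-fromℕ< k<N²)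

  cellIndex-⊔< : ∀ c d → cellIndex c ⊔ cellIndex d < N²
  cellIndex-⊔< c d = ⊔-pres-<m (cellIndex< c) (cellIndex< d)

  _≟ᶜ_ : (c d : Cell) → Dec (c ≡ d)
  _≟ᶜ_ = ≡-dec _≟ᶠ_ _≟ᶠ_

  edgeIndex : Cell → Cell → ℕ
  edgeIndex c d = N² * (cellIndex c ⊓ cellIndex d) + (cellIndex c ⊔ cellIndex d)

  -- The suc makes every port even, so that no two ports are successive numbers.
  edgeCode : Cell → Cell → ℕ
  edgeCode c d = suc (edgeIndex c d)

  edgeCode-comm : ∀ c d → edgeCode c d ≡ edgeCode d c
  edgeCode-comm c d = cong suc (cong₂ (λ u v → N² * u + v) (⊓-comm (cellIndex c) _) (⊔-comm (cellIndex c) _))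

  edgeCode-injective : ∀ {c d c' d'} → edgeCode c d ≡ edgeCode c' d' → (c ≡ c' × d ≡ d') ⊎ (c ≡ d' × d ≡ c')
  edgeCode-injective {c} {d} {c'} {d'} e
    with ⊓≡ , ⊔≡ ← *+-injective (cellIndex-⊔< c d) (cellIndex-⊔< c' d') (suc-injective e)
    with ⊓-⊔-unordered ⊓≡ ⊔≡
  ... | inj₁ (c≡c' , d≡d') = inj₁ (cellIndex-injective c≡c' , cellIndex-injective d≡d')
  ... | inj₂ (c≡d' , d≡c') = inj₂ (cellIndex-injective c≡d' , cellIndex-injective d≡c')

  K : ℕ
  K = suc (N² * N²)

  edgeCode<K : ∀ c d → edgeCode c d < K
  edgeCode<K c d = s≤s ([n*q+o]<m*n (m<n⇒m⊓o<n _ (cellIndex< c)) (cellIndex-⊔< c d))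

  B : ℕ
  B = 2 ^ K

  instance
    B≢0 : NonZero B
    B≢0 = m^n≢0 2 K

  2^<B : ∀ {k} → k < K → 2 ^ k < B
  2^<B = ^-monoʳ-< 2 (s≤s (s≤s z≤n))

  Vertex : Set
  Vertex = Cell × ℕ

  cell : Vertex → Cell
  cell = proj₁

  label : Vertex → ℕ
  label (c , o) = B * cellIndex c + o

  -- Offset 0 is left out: the missing multiples of B keep successive labels inside one block.
  IsVertex : Vertex → Set
  IsVertex (_ , o) = 0 < o × o < B

  G : Graph
  G = record { C = Vertex ; V = IsVertex ; E = λ x y → DAdj (label x) (label y) }

  label-injective : ∀ {x y} → IsVertex x → IsVertex y → label x ≡ label y → x ≡ y
  label-injective {c , o} {c' , o'} (_ , o<B) (_ , o'<B) e
    with c≡c' , refl ← *+-injective o<B o'<B e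
    with refl ← cellIndex-injective c≡c' = refl

  label< : ∀ {x} → IsVertex x → label x < N² * B
  label< {c , _} (_ , o<B) = [n*q+o]<m*n (cellIndex< c) o<B

  label%B : ∀ {x} → IsVertex x → label x % B ≡ proj₂ x
  label%B {c , _} (_ , o<B) = [n*q+o]%n≡o (cellIndex c) o<B

  successive⇒sameCell : ∀ {x y} → IsVertex x → IsVertex y → suc (label x) ≡ label y → cell x ≡ cell y
  successive⇒sameCell (_ , o<B) (0<o' , o'<B) e = cellIndex-injective (suc-*+-injective o<B 0<o' o'<B e)

  Even : Subset G
  Even x = ⌊ 2 ∣? label x ⌋

  step-suc : ∀ {x y} → suc (label x) ≡ label y → Step G Even x y
  step-suc {x} e = inj₁ (inj₁ e) , subst (λ l → Differ (Even x) ⌊ 2 ∣? l ⌋) e (Differ-2∣?-suc (label x))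

  step⇒sameCell : ∀ {x y} → IsVertex x → IsVertex y → Step G Even x y → cell x ≡ cell y
  step⇒sameCell vx vy (xy , d) =
    [ successive⇒sameCell vx vy , sym ∘ successive⇒sameCell vy vx ]′ (DAdj-Differ⇒successive xy d)

  reach⇒sameCell : ∀ x p → Reach G Even x p → cell p ≡ cell x
  reach⇒sameCell x p x⇝p = toWitness (x⇝p InCell (fromWitness refl) closed)
    where
    InCell : Subset G
    InCell z = ⌊ cell z ≟ᶜ cell x ⌋
    closed : ∀ a → IsVertex a → ∀ b → IsVertex b → T (InCell a) → Step G Even a b → T (InCell b)
    closed a va b vb a∈ ab = fromWitness (trans (sym (step⇒sameCell va vb ab)) (toWitness a∈))

  reach-within-cell : ∀ {c o} → IsVertex (c , o) → Reach G Even (c , 1) (c , o)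
  reach-within-cell {c} {suc zero} _ = reach-refl {G} {Even}
  reach-within-cell {c} {suc (suc o)} (_ , 2+o<B) =
    reach-step {G} {Even} (reach-within-cell (z<s , 1+o<B)) (z<s , 1+o<B) (z<s , 2+o<B) (step-suc (sym (+-suc _ _)))
    where
    1+o<B : suc o < B
    1+o<B = <-trans (n<1+n _) 2+o<B

  Representative : Subset G
  Representative (_ , o) = ⌊ o ≟ℕ 1 ⌋

  Port : Subset G
  Port (c , o) = ⌊ any²? (λ d → GridAdj? c d ×-dec o ≟ℕ 2 ^ edgeCode c d) ⌋

  port : Cell → Cell → Vertex
  port c d = c , 2 ^ edgeCode c d

  port-isVertex : ∀ c d → IsVertex (port c d)
  port-isVertex c d = m^n>0 2 (edgeCode c d) , 2^<B (edgeCode<K c d)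

  port-valuation : ∀ c d → LargestPow2 (edgeCode c d) (label (port c d))
  port-valuation c d = LargestPow2-*+ (cellIndex c) (edgeCode<K c d)

  port-even : ∀ c d → 2 ∣ label (port c d)
  port-even c d = LargestPow2-suc⇒2∣ {edgeIndex c d} (port-valuation c d)

  linked-sound : ∀ x y → Linked G Even Port x y → GridAdj (cell x) (cell y)
  linked-sound x y ((c , o) , _ , (c' , o') , _ , x⇝p , y⇝q , p∈Port , q∈Port , pq , p≢q)
    with refl ← reach⇒sameCell x _ x⇝p
    with refl ← reach⇒sameCell y _ y⇝q
    with d , cd , refl ← toWitness p∈Port
    with d' , _ , refl ← toWitness q∈Port
    with pq
  ... | inj₁ successive = ⊥-elim (evens-not-successive (port-even c d) (port-even c' d') successive)
  ... | inj₂ (_ , e , vp , vq)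
    with edgeCode-injective (trans (LargestPow2-unique {edgeCode c d} (port-valuation c d) vp)
                                  (LargestPow2-unique {e} vq (port-valuation c' d')))
  ... | inj₁ (refl , refl) = ⊥-elim (p≢q refl)
  ... | inj₂ (refl , refl) = cd

  linked-complete : ∀ {c c'} → GridAdj c c' → Linked G Even Port (c , 1) (c' , 1)
  linked-complete {c} {c'} cc' =
      port c c' , port-isVertex c c' , port c' c , port-isVertex c' c
    , reach-within-cell (port-isVertex c c') , reach-within-cell (port-isVertex c' c)
    , fromWitness (c' , cc' , refl) , fromWitness (c , GridAdj-sym cc' , refl)
    , inj₂ (c≢c' ∘ cong cell ∘ label-injective (port-isVertex c c') (port-isVertex c' c)
           , edgeCode c c' , port-valuation c c'
           , subst (λ k → LargestPow2 k (label (port c' c))) (edgeCode-comm c' c) (port-valuation c' c))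
    , c≢c' ∘ cong cell
    where
    c≢c' : c ≢ c'
    c≢c' refl = GridAdj-irrefl cc'

  Parameters : Fin 3 → Subset G
  Parameters = Representative ∷ᶠ Even ∷ᶠ Port ∷ᶠ []ᶠ

  grid-iso : apply Θ G Parameters ≅ Grid n
  grid-iso = record
    { f     = cell
    ; pres  = λ _ _ → tt
    ; inj   = λ { (c , o) (_ , o') (_ , o≡1) (_ , o'≡1) refl →
                  cong (c ,_) (trans (toWitness o≡1) (sym (toWitness o'≡1))) }
    ; surj  = λ c _ → (c , 1) , ((z<s , 2^<B {0} z<s) , tt) , refl
    ; edges = edges
    }
    where
    edges : ∀ x y → IsVertex x × T (Representative x) → IsVertex y × T (Representative y) →
            Linked G Even Port x y ⇔ GridAdj (cell x) (cell y)
    edges (c , o) (c' , o') (_ , o≡1) (_ , o'≡1)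
      with refl ← toWitness o≡1 | refl ← toWitness o'≡1 = mk⇔ (linked-sound _ _) linked-complete

  m : ℕ
  m = N² * B

  instance
    m≢0 : NonZero m
    m≢0 = m*n≢0 N² B

  Blocks : Fin m → Bool
  Blocks y = 0 <ᵇ suc (toℕ y) % B

  -- The mod only makes toD total; on vertices toD x is label x − 1 (suc-toD).
  toD : Vertex → Fin m
  toD x = pred (label x) mod m

  suc-toD : ∀ {x} → IsVertex x → suc (toℕ (toD x)) ≡ label x
  suc-toD {c , o} vx@(0<o , _) = begin-equality
    suc (toℕ (toD (c , o)))    ≡⟨ cong suc (toℕ-fromℕ< (m%n<n (pred l) m)) ⟩
    suc (pred l % m)           ≡⟨ cong suc (m<n⇒m%n≡m (≤-<-trans pred[n]≤n (label< vx))) ⟩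
    suc (pred l)               ≡⟨ suc-pred l {{>-nonZero (<-≤-trans 0<o (m≤n+m o (B * cellIndex c)))}} ⟩
    l                          ∎
    where
    l : ℕ
    l = label (c , o)

  Blocks-toD : ∀ {x} → IsVertex x → T (Blocks (toD x))
  Blocks-toD vx = subst (λ l → T (0 <ᵇ l % B)) (sym (suc-toD vx))
                    (subst (T ∘ (0 <ᵇ_)) (sym (label%B vx)) (<⇒<ᵇ (proj₁ vx)))

  toD-surjective : ∀ y → T (Blocks y) → Σ Vertex λ x → IsVertex x × toD x ≡ y
  toD-surjective y y∈ = (c , a % B) , vx , toℕ-injective (suc-injective (trans (suc-toD vx) label≡a))
    where
    a : ℕ
    a = suc (toℕ y)
    0<a%B : 0 < a % B
    0<a%B = <ᵇ⇒< 0 (a % B) y∈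
    cell-of-a/B : Σ Cell λ c → cellIndex c ≡ a / B
    cell-of-a/B = cellIndex-surjective (m≤o*n∧0<m%n⇒m/n<o (toℕ<n y) 0<a%B)
    c : Cell
    c = proj₁ cell-of-a/B
    vx : IsVertex (c , a % B)
    vx = 0<a%B , m%n<n a B
    label≡a : label (c , a % B) ≡ a
    label≡a = begin-equality
      B * cellIndex c + a % B   ≡⟨ cong (λ k → B * k + a % B) (proj₂ cell-of-a/B) ⟩
      B * (a / B) + a % B       ≡⟨ +-comm (B * (a / B)) (a % B) ⟩
      a % B + B * (a / B)       ≡⟨ cong (a % B +_) (*-comm B (a / B)) ⟩
      a % B + a / B * B         ≡⟨ m≡m%n+[m/n]*n a B ⟨
      a                         ∎

  embedding : G ≅ Induced (D m) Blocks
  embedding = record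
    { f     = toD
    ; pres  = λ _ vx → tt , Blocks-toD vx
    ; inj   = λ _ _ vx vy e → label-injective vx vy (trans (sym (suc-toD vx)) (trans (cong (suc ∘ toℕ) e) (suc-toD vy)))
    ; surj  = λ y (_ , y∈) → toD-surjective y y∈
    ; edges = λ _ _ vx vy → mk⇔ (subst₂ DAdj (sym (suc-toD vx)) (sym (suc-toD vy)))
                                (subst₂ DAdj (suc-toD vx) (suc-toD vy))
    }

theorem7 : Σ Interpretation λ Θ → (n : ℕ) → 1 ≤ n →
    Σ Graph λ G → IsPowerGraph G ×
    Σ (Fin (params Θ) → Subset G) λ A → apply Θ G A ≅ Grid n
theorem7 = Θ , λ n 1≤n → let open BlockGraph n {{>-nonZero 1≤n}} in
  G , (m , Blocks , embedding) , Parameters , grid-iso
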